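{- Let $n \ge 1$ and write $n = 2^j \cdot k$ with $j \ge 0$ and $k \ge 1$ odd. Write $j = 2r + s$ with $r \ge 0$, $s \in \{0,1\}$, and $k = 4t + u$ with $t \ge 0$, $u \in \{1,3\}$. Then (1) $C(n) = 1$ if and only if ($s = 0$ and $u = 3$) or ($s = 1$ and $u = 1$); (2) $C(n) = 0$ if and only if ($s = 0$ and $u = 1$) or ($s = 1$ and $u = 3$).
   Context: The function $C:\mathbb{Z}^+\to\{0,1\}$ is defined recursively by $C(1) = 0$, $C(n) = 1 - C(n-2)$ if $n > 1$ is odd, and $C(n) = 1 - C(n/2)$ if $n$ is even. -}

module Defs where

open import Data.Nat using (ℕ; zero; suc; _∸_; _/_; _%_)

-- Since every recursive call strictly decreases the argument, fuel f ≥ n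
-- suffices, and C n = Cf n n is exactly the paper's C on positive integers:
--   C(1) = 0,  C(n) = 1 - C(n-2) for odd n > 1,  C(n) = 1 - C(n/2) for even n.
-- Values are 0/1 in ℕ; "1 - x" is truncated subtraction (exact on {0,1}).
-- The value at n = 0 is an irrelevant dummy (C is only defined on ℤ⁺).
Cf : ℕ → ℕ → ℕ
Cf zero _ = 0
Cf (suc f) zero = 0
Cf (suc f) (suc zero) = 0
Cf (suc f) (suc (suc m)) with (suc (suc m)) % 2
... | zero = 1 ∸ Cf f ((suc (suc m)) / 2)
... | suc _ = 1 ∸ Cf f m

C : ℕ → ℕ
C n = Cf n n

{-# OPTIONS --safe #-}
module Submission where

-- C only ever toggles a bit: doubling toggles it, and so does stepping from k to k + 2
-- within the odd numbers.  Hence C(2^j k) is C(k) toggled j times, C(1 + 2m) is 0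
-- toggled m times, and, since toggling twice is the identity on bits, only the
-- parities of j and of (k - 1)/2 matter.

open import Defs
open import Data.Nat using (ℕ; zero; suc; _+_; _*_; _^_; _≤_; _%_; _/_; _∸_; z≤n; s≤s; s≤s⁻¹)
open import Data.Nat.Properties
  using (≤-refl; <⇒≤; ≤-trans; m∸n≤m; m∸[m∸n]≡n; *-identityˡ; *-assoc; *-comm; *-mono-≤; m^n>0; m≤m*n; n≤1+n)
open import Data.Nat.DivMod using ([m+kn]%n≡m%n; m*n%n≡0; m*n/n≡m; m/n<m)
open import Data.Nat.GeneralisedArithmetic using (fold)
open import Data.Nat.Tactic.RingSolver using (solve-∀)
open import Data.Product using (_×_; _,_)
open import Data.Sum using (_⊎_; inj₁; inj₂)
open import Data.Empty using (⊥-elim)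
open import Function.Base using (const)
open import Function.Bundles using (_⇔_; mk⇔)
open import Relation.Nullary using (¬_)
open import Relation.Binary.PropositionalEquality using (_≡_; refl; cong; trans; module ≡-Reasoning)

open ≡-Reasoning

toggle : ℕ → ℕ
toggle = 1 ∸_

toggle-≤1 : ∀ x → toggle x ≤ 1
toggle-≤1 = m∸n≤m 1

toggled : ℕ → ℕ → ℕ
toggled j b = fold b toggle j

toggled-≤1 : ∀ j {b} → b ≤ 1 → toggled j b ≤ 1
toggled-≤1 zero    b≤1 = b≤1
toggled-≤1 (suc j) _   = toggle-≤1 (toggled j _)

-- Multiples of two are written r * 2 here and below, so that suc r * 2 + s reduces
-- to 2 + (r * 2 + s) and 1 + suc m * 2 to 3 + m * 2.
toggled-period-2 : ∀ r s {b} → b ≤ 1 → toggled (r * 2 + s) b ≡ toggled s b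
toggled-period-2 zero    s b≤1 = refl
toggled-period-2 (suc r) s {b} b≤1 = begin
  toggle (toggle (toggled (r * 2 + s) b)) ≡⟨ m∸[m∸n]≡n (toggled-≤1 (r * 2 + s) b≤1) ⟩
  toggled (r * 2 + s) b                   ≡⟨ toggled-period-2 r s b≤1 ⟩
  toggled s b                             ∎

Cf-fuel-irrelevant : ∀ f g n → n ≤ f → n ≤ g → Cf f n ≡ Cf g n
Cf-fuel-irrelevant zero    zero    zero _ _ = refl
Cf-fuel-irrelevant zero    (suc g) zero _ _ = refl
Cf-fuel-irrelevant (suc f) zero    zero _ _ = refl
Cf-fuel-irrelevant (suc f) (suc g) zero _ _ = refl
Cf-fuel-irrelevant (suc f) (suc g) (suc zero) _ _ = refl
Cf-fuel-irrelevant (suc f) (suc g) (suc (suc m)) (s≤s m<f) (s≤s m<g)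
  with suc (suc m) % 2
... | zero  = cong toggle (Cf-fuel-irrelevant f g _ (half≤ m<f) (half≤ m<g))
  where
  half≤ : ∀ {h} → suc m ≤ h → suc (suc m) / 2 ≤ h
  half≤ = ≤-trans (s≤s⁻¹ (m/n<m (suc (suc m)) 2 (s≤s (s≤s z≤n))))
... | suc _ = cong toggle (Cf-fuel-irrelevant f g m (<⇒≤ m<f) (<⇒≤ m<g))

Cf≡C : ∀ {f n} → n ≤ f → Cf f n ≡ C n
Cf≡C {f} {n} n≤f = Cf-fuel-irrelevant f n n n≤f ≤-refl

C-≤1 : ∀ n → C n ≤ 1
C-≤1 n = Cf-≤1 n n
  where
  Cf-≤1 : ∀ f n → Cf f n ≤ 1
  Cf-≤1 zero    _             = z≤n
  Cf-≤1 (suc f) zero          = z≤n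
  Cf-≤1 (suc f) (suc zero)    = z≤n
  Cf-≤1 (suc f) (suc (suc m)) with suc (suc m) % 2
  ... | zero  = toggle-≤1 (Cf f (suc (suc m) / 2))
  ... | suc _ = toggle-≤1 (Cf f m)

Cf-unfold-even : ∀ f m → suc (suc m) % 2 ≡ 0 →
                 Cf (suc f) (suc (suc m)) ≡ toggle (Cf f (suc (suc m) / 2))
Cf-unfold-even f m _ with suc (suc m) % 2
Cf-unfold-even f m refl | zero = refl

Cf-unfold-odd : ∀ f m → suc (suc m) % 2 ≡ 1 → Cf (suc f) (suc (suc m)) ≡ toggle (Cf f m)
Cf-unfold-odd f m _ with suc (suc m) % 2
Cf-unfold-odd f m refl | suc zero = refl

C-double : ∀ {n} → 1 ≤ n → C (n * 2) ≡ toggle (C n)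
C-double {n@(suc m)} _ = begin
  C (n * 2)                             ≡⟨ Cf-unfold-even _ (m * 2) (m*n%n≡0 n 2) ⟩
  toggle (Cf (suc (m * 2)) (n * 2 / 2)) ≡⟨ cong (λ x → toggle (Cf (suc (m * 2)) x)) (m*n/n≡m n 2) ⟩
  toggle (Cf (suc (m * 2)) n)           ≡⟨ cong toggle (Cf≡C (s≤s (m≤m*n m 2))) ⟩
  toggle (C n)                          ∎

C-odd-step : ∀ m → C (3 + m * 2) ≡ toggle (C (1 + m * 2))
C-odd-step m = begin
  C (3 + m * 2)                       ≡⟨ Cf-unfold-odd _ (1 + m * 2) ([m+kn]%n≡m%n 1 (suc m) 2) ⟩
  toggle (Cf (2 + m * 2) (1 + m * 2)) ≡⟨ cong toggle (Cf≡C (n≤1+n (1 + m * 2))) ⟩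
  toggle (C (1 + m * 2))              ∎

C-odd : ∀ m → C (1 + m * 2) ≡ toggled m 0
C-odd zero    = refl
C-odd (suc m) = trans (C-odd-step m) (cong toggle (C-odd m))

C-4t+1 : ∀ t → C (4 * t + 1) ≡ 0
C-4t+1 t = begin
  C (4 * t + 1)             ≡⟨ cong C (4t+1≡ t) ⟩
  C (1 + (t * 2 + 0) * 2)   ≡⟨ C-odd (t * 2 + 0) ⟩
  toggled (t * 2 + 0) 0     ≡⟨ toggled-period-2 t 0 z≤n ⟩
  0                         ∎
  where
  4t+1≡ : ∀ t → 4 * t + 1 ≡ 1 + (t * 2 + 0) * 2
  4t+1≡ = solve-∀

C-4t+3 : ∀ t → C (4 * t + 3) ≡ 1
C-4t+3 t = begin
  C (4 * t + 3)             ≡⟨ cong C (4t+3≡ t) ⟩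
  C (1 + (t * 2 + 1) * 2)   ≡⟨ C-odd (t * 2 + 1) ⟩
  toggled (t * 2 + 1) 0     ≡⟨ toggled-period-2 t 1 z≤n ⟩
  1                         ∎
  where
  4t+3≡ : ∀ t → 4 * t + 3 ≡ 1 + (t * 2 + 1) * 2
  4t+3≡ = solve-∀

C-2^* : ∀ j {k} → 1 ≤ k → C (2 ^ j * k) ≡ toggled j (C k)
C-2^* zero    {k} _   = cong C (*-identityˡ k)
C-2^* (suc j) {k} k≥1 = begin
  C (2 ^ suc j * k)       ≡⟨ cong C (trans (*-assoc 2 (2 ^ j) k) (*-comm 2 (2 ^ j * k))) ⟩
  C (2 ^ j * k * 2)       ≡⟨ C-double (*-mono-≤ (m^n>0 2 j) k≥1) ⟩
  toggle (C (2 ^ j * k))  ≡⟨ cong toggle (C-2^* j k≥1) ⟩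
  toggled (suc j) (C k)   ∎

C-2^[2r+s]* : ∀ r s {k} → 1 ≤ k → C (2 ^ (2 * r + s) * k) ≡ toggled s (C k)
C-2^[2r+s]* r s {k} k≥1 = begin
  C (2 ^ (2 * r + s) * k)   ≡⟨ C-2^* (2 * r + s) k≥1 ⟩
  toggled (2 * r + s) (C k) ≡⟨ cong (λ j → toggled (j + s) (C k)) (*-comm 2 r) ⟩
  toggled (r * 2 + s) (C k) ≡⟨ toggled-period-2 r s (C-≤1 k) ⟩
  toggled s (C k)           ∎

≡1⇒⇔ : ∀ {x} {P Q : Set} → x ≡ 1 → P → ¬ Q → (x ≡ 1 ⇔ P) × (x ≡ 0 ⇔ Q)
≡1⇒⇔ refl p ¬q = mk⇔ (const p) (const refl) , mk⇔ (λ ()) (λ q → ⊥-elim (¬q q))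

≡0⇒⇔ : ∀ {x} {P Q : Set} → x ≡ 0 → ¬ P → Q → (x ≡ 1 ⇔ P) × (x ≡ 0 ⇔ Q)
≡0⇒⇔ refl ¬p q = mk⇔ (λ ()) (λ p → ⊥-elim (¬p p)) , mk⇔ (const q) (const refl)

proposition2p3 : (n j k r s t u : ℕ) → 1 ≤ n → n ≡ 2 ^ j * k → 1 ≤ k → k % 2 ≡ 1 →
    j ≡ 2 * r + s → (s ≡ 0 ⊎ s ≡ 1) → k ≡ 4 * t + u → (u ≡ 1 ⊎ u ≡ 3) →
    ((C n ≡ 1) ⇔ ((s ≡ 0 × u ≡ 3) ⊎ (s ≡ 1 × u ≡ 1)))
      × ((C n ≡ 0) ⇔ ((s ≡ 0 × u ≡ 1) ⊎ (s ≡ 1 × u ≡ 3)))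
-- 1 ≤ n and k % 2 ≡ 1 are unused: they follow from k ≡ 4 * t + u with u odd.
proposition2p3 _ _ _ r _ t _ _ refl k≥1 _ refl (inj₁ refl) refl (inj₁ refl) =
  ≡0⇒⇔ (trans (C-2^[2r+s]* r 0 k≥1) (C-4t+1 t))
       (λ { (inj₁ (_ , ())) ; (inj₂ (() , _)) }) (inj₁ (refl , refl))
proposition2p3 _ _ _ r _ t _ _ refl k≥1 _ refl (inj₁ refl) refl (inj₂ refl) =
  ≡1⇒⇔ (trans (C-2^[2r+s]* r 0 k≥1) (C-4t+3 t))
       (inj₁ (refl , refl)) (λ { (inj₁ (_ , ())) ; (inj₂ (() , _)) })
proposition2p3 _ _ _ r _ t _ _ refl k≥1 _ refl (inj₂ refl) refl (inj₁ refl) =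
  ≡1⇒⇔ (trans (C-2^[2r+s]* r 1 k≥1) (cong toggle (C-4t+1 t)))
       (inj₂ (refl , refl)) (λ { (inj₁ (() , _)) ; (inj₂ (_ , ())) })
proposition2p3 _ _ _ r _ t _ _ refl k≥1 _ refl (inj₂ refl) refl (inj₂ refl) =
  ≡0⇒⇔ (trans (C-2^[2r+s]* r 1 k≥1) (cong toggle (C-4t+3 t)))
       (λ { (inj₁ (() , _)) ; (inj₂ (_ , ())) }) (inj₂ (refl , refl))
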